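{- Let $g$ be the $84$-uniform morphism $0\mapsto 100101100100110010100101100101001011001001100101100101001011001001100101100100110010$, $1\mapsto 100101100100110010100101100101001011001001100101100101001011001001100101001011001001$, $2\mapsto 100101100100110010100101100101001011001001100101100100110010100101100100110010110010$. For any infinite squarefree word $\mathbf u$ over $\{0,1,2\}$, the word $g(\mathbf u)$ is $\tfrac{29}{11}^+$-free, contains no pair of complementary factors of length $8$, and has exactly $36$ complementary factors (nonempty words $x$ such that both $x$ and $\overline{x}$ are factors of $g(\mathbf u)$).
   Context: $\overline{x}$ is obtained from a binary word $x$ by exchanging $0$ and $1$. A word is squarefree if it has no nonempty factor of the form $yy$. For a finite word $w$, $\exp(w)=|w|/\mathrm{per}(w)$ with $\mathrm{per}(w)$ its smallest period; a word is $\beta^+$-free if every nonempty factor has exponent $\le\beta$. -}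

module Defs where

open import Data.Nat using (ℕ; zero; suc; _+_; _*_; _≤_; _<_)
open import Data.Nat.DivMod using (_/_; _%_; m%n<n)
open import Data.Bool using (Bool; true; false; not)
open import Data.Fin using (Fin; fromℕ<)
open import Data.List using (List; []; _∷_; length; map)
open import Data.List.Membership.Propositional using (_∈_)
open import Data.List.Relation.Unary.Unique.Propositional using (Unique)
open import Data.Maybe using (Maybe; just; nothing)
open import Data.Product using (Σ; _×_; ∃)
open import Function.Bundles using (_⇔_)
open import Relation.Binary.PropositionalEquality using (_≡_)
open import Relation.Nullary using (¬_)

-- Binary letters: false = 0, true = 1.  Ternary letters: Fin 3.
-- Infinite words are functions ℕ → A; finite words are lists.

bit : ℕ → Bool
bit zero = false
bit (suc _) = true

bits : List ℕ → List Bool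
bits = map bit

g0 g1 g2 : List Bool
g0 = bits (1 ∷ 0 ∷ 0 ∷ 1 ∷ 0 ∷ 1 ∷ 1 ∷ 0 ∷ 0 ∷ 1 ∷ 0 ∷ 0 ∷ 1 ∷ 1 ∷ 0 ∷ 0 ∷ 1 ∷ 0 ∷ 1 ∷ 0 ∷ 0 ∷ 1 ∷ 0 ∷ 1 ∷ 1 ∷ 0 ∷ 0 ∷ 1 ∷ 0 ∷ 1 ∷ 0 ∷ 0 ∷ 1 ∷ 0 ∷ 1 ∷ 1 ∷ 0 ∷ 0 ∷ 1 ∷ 0 ∷ 0 ∷ 1 ∷ 1 ∷ 0 ∷ 0 ∷ 1 ∷ 0 ∷ 1 ∷ 1 ∷ 0 ∷ 0 ∷ 1 ∷ 0 ∷ 1 ∷ 0 ∷ 0 ∷ 1 ∷ 0 ∷ 1 ∷ 1 ∷ 0 ∷ 0 ∷ 1 ∷ 0 ∷ 0 ∷ 1 ∷ 1 ∷ 0 ∷ 0 ∷ 1 ∷ 0 ∷ 1 ∷ 1 ∷ 0 ∷ 0 ∷ 1 ∷ 0 ∷ 0 ∷ 1 ∷ 1 ∷ 0 ∷ 0 ∷ 1 ∷ 0 ∷ [])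
g1 = bits (1 ∷ 0 ∷ 0 ∷ 1 ∷ 0 ∷ 1 ∷ 1 ∷ 0 ∷ 0 ∷ 1 ∷ 0 ∷ 0 ∷ 1 ∷ 1 ∷ 0 ∷ 0 ∷ 1 ∷ 0 ∷ 1 ∷ 0 ∷ 0 ∷ 1 ∷ 0 ∷ 1 ∷ 1 ∷ 0 ∷ 0 ∷ 1 ∷ 0 ∷ 1 ∷ 0 ∷ 0 ∷ 1 ∷ 0 ∷ 1 ∷ 1 ∷ 0 ∷ 0 ∷ 1 ∷ 0 ∷ 0 ∷ 1 ∷ 1 ∷ 0 ∷ 0 ∷ 1 ∷ 0 ∷ 1 ∷ 1 ∷ 0 ∷ 0 ∷ 1 ∷ 0 ∷ 1 ∷ 0 ∷ 0 ∷ 1 ∷ 0 ∷ 1 ∷ 1 ∷ 0 ∷ 0 ∷ 1 ∷ 0 ∷ 0 ∷ 1 ∷ 1 ∷ 0 ∷ 0 ∷ 1 ∷ 0 ∷ 1 ∷ 0 ∷ 0 ∷ 1 ∷ 0 ∷ 1 ∷ 1 ∷ 0 ∷ 0 ∷ 1 ∷ 0 ∷ 0 ∷ 1 ∷ [])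
g2 = bits (1 ∷ 0 ∷ 0 ∷ 1 ∷ 0 ∷ 1 ∷ 1 ∷ 0 ∷ 0 ∷ 1 ∷ 0 ∷ 0 ∷ 1 ∷ 1 ∷ 0 ∷ 0 ∷ 1 ∷ 0 ∷ 1 ∷ 0 ∷ 0 ∷ 1 ∷ 0 ∷ 1 ∷ 1 ∷ 0 ∷ 0 ∷ 1 ∷ 0 ∷ 1 ∷ 0 ∷ 0 ∷ 1 ∷ 0 ∷ 1 ∷ 1 ∷ 0 ∷ 0 ∷ 1 ∷ 0 ∷ 0 ∷ 1 ∷ 1 ∷ 0 ∷ 0 ∷ 1 ∷ 0 ∷ 1 ∷ 1 ∷ 0 ∷ 0 ∷ 1 ∷ 0 ∷ 0 ∷ 1 ∷ 1 ∷ 0 ∷ 0 ∷ 1 ∷ 0 ∷ 1 ∷ 0 ∷ 0 ∷ 1 ∷ 0 ∷ 1 ∷ 1 ∷ 0 ∷ 0 ∷ 1 ∷ 0 ∷ 0 ∷ 1 ∷ 1 ∷ 0 ∷ 0 ∷ 1 ∷ 0 ∷ 1 ∷ 1 ∷ 0 ∷ 0 ∷ 1 ∷ 0 ∷ [])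

_!_ : {A : Set} → List A → ℕ → Maybe A
[] ! _ = nothing
(x ∷ xs) ! zero = just x
(x ∷ xs) ! suc i = xs ! i

gLetter : Fin 3 → List Bool
gLetter Fin.zero = g0
gLetter (Fin.suc Fin.zero) = g1
gLetter (Fin.suc (Fin.suc Fin.zero)) = g2

-- letter at position i of g(u): position i lies in block i / 84, offset i % 84
-- (g is 84-uniform, so g(u) is the concatenation of the blocks g(u 0) g(u 1) ...)
gInf : (ℕ → Fin 3) → ℕ → Bool
gInf u i with gLetter (u (i / 84)) ! (i % 84)
... | just b = b
... | nothing = false   -- unreachable: every image has length 84

OccursAt : {A : Set} → List A → (ℕ → A) → ℕ → Set
OccursAt x w i = ∀ j → j < length x → x ! j ≡ just (w (i + j))

IsFactor : {A : Set} → List A → (ℕ → A) → Set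
IsFactor x w = ∃ λ i → OccursAt x w i

SquareFree : {A : Set} → (ℕ → A) → Set
SquareFree w = ¬ (Σ (List _) λ y → (1 ≤ length y) × IsFactor (Data.List._++_ y y) w)

compl : List Bool → List Bool
compl = map not

IsPeriod : {A : Set} → List A → ℕ → Set
IsPeriod x p = (1 ≤ p) × (p ≤ length x) × (∀ i → i + p < length x → x ! i ≡ x ! (i + p))

IsSmallestPeriod : {A : Set} → List A → ℕ → Set
IsSmallestPeriod x p = IsPeriod x p × (∀ q → IsPeriod x q → p ≤ q)

-- w is (a/b)⁺-free: every nonempty factor x satisfies exp(x) = |x|/per(x) ≤ a/b,
-- i.e. b·|x| ≤ a·per(x)
RatPlusFree : {A : Set} → ℕ → ℕ → (ℕ → A) → Set
RatPlusFree a b w = ∀ x → 1 ≤ length x → IsFactor x w →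
  ∀ p → IsSmallestPeriod x p → b * length x ≤ a * p

IsComplFactor : List Bool → (ℕ → Bool) → Set
IsComplFactor x w = (1 ≤ length x) × IsFactor x w × IsFactor (compl x) w

HasExactlyComplFactors : ℕ → (ℕ → Bool) → Set
HasExactlyComplFactors n w =
  Σ (List (List Bool)) λ xs → (length xs ≡ n) × Unique xs × (∀ x → (x ∈ xs) ⇔ IsComplFactor x w)

-- A factor of g(u) of bounded length lies in the image of a few consecutive letters of u, which
-- contain no two equal neighbours because u is squarefree; so each local property of g(u) reduces
-- to finitely many cases, decided by evaluation.  Suppose a factor of g(u) has period p and
-- exponent above 29/11.  For p ≤ 37 and p = 84 no such factor occurs in the image of any four
-- such letters.  For the other p ≥ 38 the factor has length at least p + 62; since a factor of
-- length 62 determines its position modulo 84, p = 84q with q ≥ 2, so the repetition covers 2q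
-- whole blocks, and injectivity of g on letters yields a square of length q in u.  The
-- complementary factors are read off the factors of length at most 8 of the images of two
-- letters, the longer ones being excluded by their prefixes of length 8.

module Submission where

open import Defs
open import Data.Bool using (Bool; true; false; not; T; _∧_; _∨_)
import Data.Bool.Properties as Bool
open import Data.Bool.ListAction using (all; any)
open import Data.Empty using (⊥; ⊥-elim)
open import Data.Fin as Fin using (Fin)
open import Data.List.Base using (List; []; _∷_; _++_; length; map; take; drop; concatMap; upTo; applyUpTo; allFin; filter; foldr; cartesianProductWith)
open import Data.List.Properties using (length-map; length-take; take-map; drop-drop)
import Data.List.Properties as List
open import Data.List.Membership.Propositional using (_∈_)
open import Data.List.Membership.Propositional.Properties using (∈-applyUpTo⁺; ∈-allFin; ∈-filter⁺; ∈-cartesianProductWith⁺; ∈-concatMap⁺)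
import Data.List.Relation.Unary.All as All
open import Data.List.Relation.Unary.All.Properties using (all⁺)
open import Data.List.Relation.Unary.Any as Any using (here; there)
open import Data.List.Relation.Unary.Any.Properties using (any⁻)
open import Data.Maybe.Base using (Maybe; just; nothing; is-just)
open import Data.Maybe.Properties using (just-injective)
import Data.Maybe.Properties as Maybe
open import Data.Nat.Base using (_≤ᵇ_; ℕ; zero; suc; _+_; _*_; _∸_; _⊓_; _≤_; _<_; z≤n; s≤s; z<s; s<s; NonZero)
open import Data.Nat.Properties
open import Data.Nat.Tactic.RingSolver using (solve-∀)
open import Data.Nat.DivMod using (m<n*o⇒m/o<n; _/_; _%_; m%n<n; m≡m%n+[m/n]*n; +-distrib-/-∣ˡ; %-remove-+ˡ; m*n/n≡m; m<n⇒m/n≡0; m<n⇒m%n≡m)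
open import Data.Nat.Divisibility using (_∣_; divides; n∣m*n; ∣m+n∣m⇒∣n)
open import Data.Unit.Base using (⊤; tt)
open import Data.Product.Base using (Σ; ∃; _×_; _,_; proj₁; uncurry)
open import Data.Sum.Base using (_⊎_; inj₁; inj₂; [_,_]′)
open import Function.Base using (_∘_)
open import Function.Bundles using (mk⇔; Equivalence)
open import Relation.Binary.PropositionalEquality
open import Relation.Nullary using (¬_; Dec; yes; no; contradiction)
open import Relation.Nullary.Decidable using (⌊_⌋; T?; toWitness; fromWitness; fromWitnessFalse; from-yes)

segment : {A : Set} → (ℕ → A) → ℕ → ℕ → List A
segment w i zero = []
segment w i (suc n) = w i ∷ segment w (suc i) n

module _ {A : Set} where

  length-segment : ∀ (w : ℕ → A) i n → length (segment w i n) ≡ n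
  length-segment w i zero = refl
  length-segment w i (suc n) = cong suc (length-segment w (suc i) n)

  segment-! : ∀ (w : ℕ → A) i {n j} → j < n → segment w i n ! j ≡ just (w (i + j))
  segment-! w i {j = zero} z<s = cong (just ∘ w) (sym (+-identityʳ i))
  segment-! w i {j = suc j} (s<s j<n) = trans (segment-! w (suc i) j<n) (cong (just ∘ w) (sym (+-suc i j)))

  occursAt-segment : ∀ (w : ℕ → A) i n → OccursAt (segment w i n) w i
  occursAt-segment w i n j j< = segment-! w i (subst (j <_) (length-segment w i n) j<)

  occursAt⇒segment : ∀ x {w : ℕ → A} {i} → OccursAt x w i → x ≡ segment w i (length x)
  occursAt⇒segment [] occ = refl
  occursAt⇒segment (a ∷ x) {w} {i} occ = cong₂ _∷_ head (occursAt⇒segment x tail)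
    where
    head : a ≡ w i
    head = just-injective (trans (occ 0 z<s) (cong (just ∘ w) (+-identityʳ i)))
    tail : OccursAt x w (suc i)
    tail j j< = trans (occ (suc j) (s<s j<)) (cong (just ∘ w) (+-suc i j))

  segment-cong : ∀ {w w′ : ℕ → A} {i i′} l → (∀ j → j < l → w (i + j) ≡ w′ (i′ + j)) →
                 segment w i l ≡ segment w′ i′ l
  segment-cong {w} {w′} {i} {i′} zero eq = refl
  segment-cong {w} {w′} {i} {i′} (suc l) eq = cong₂ _∷_ head (segment-cong l tail)
    where
    head : w i ≡ w′ i′
    head = subst₂ (λ a b → w a ≡ w′ b) (+-identityʳ i) (+-identityʳ i′) (eq 0 z<s)
    tail : ∀ j → j < l → w (suc i + j) ≡ w′ (suc i′ + j)
    tail j j< = subst₂ (λ a b → w a ≡ w′ b) (+-suc i j) (+-suc i′ j) (eq (suc j) (s<s j<))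

  segment-+ : ∀ (w : ℕ → A) i m n → segment w i (m + n) ≡ segment w i m ++ segment w (i + m) n
  segment-+ w i zero n = cong (λ k → segment w k n) (sym (+-identityʳ i))
  segment-+ w i (suc m) n = cong (w i ∷_)
    (trans (segment-+ w (suc i) m n) (cong (λ k → segment w (suc i) m ++ segment w k n) (sym (+-suc i m))))

  take-segment : ∀ (w : ℕ → A) i l n → take l (segment w i n) ≡ segment w i (l ⊓ n)
  take-segment w i zero n = refl
  take-segment w i (suc l) zero = refl
  take-segment w i (suc l) (suc n) = cong (w i ∷_) (take-segment w (suc i) l n)

  drop-segment : ∀ (w : ℕ → A) i r n → drop r (segment w i n) ≡ segment w (i + r) (n ∸ r)
  drop-segment w i zero n = cong (λ k → segment w k n) (sym (+-identityʳ i))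
  drop-segment w i (suc r) zero = refl
  drop-segment w i (suc r) (suc n) = trans (drop-segment w (suc i) r n) (cong (λ k → segment w k (n ∸ r)) (sym (+-suc i r)))

  window-segment : ∀ (w : ℕ → A) i r l n → take l (drop r (segment w i n)) ≡ segment w (i + r) (l ⊓ (n ∸ r))
  window-segment w i r l n = trans (cong (take l) (drop-segment w i r n)) (take-segment w (i + r) l (n ∸ r))

  window≡⇒occursAt : ∀ {x} {w : ℕ → A} {i r n} → take (length x) (drop r (segment w i n)) ≡ x → OccursAt x w (i + r)
  window≡⇒occursAt {x} {w} {i} {r} {n} eq = subst (λ y → OccursAt y w (i + r))
    (trans (sym (window-segment w i r (length x) n)) eq) (occursAt-segment w (i + r) (length x ⊓ (n ∸ r)))

  occursAt-take : ∀ {x} {w : ℕ → A} {i} l → OccursAt x w i → OccursAt (take l x) w i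
  occursAt-take {x} {w} {i} l occ =
    subst (λ y → OccursAt (take l y) w i) (sym (occursAt⇒segment x occ))
      (subst (λ y → OccursAt y w i) (sym (take-segment w i l (length x))) (occursAt-segment w i (l ⊓ length x)))

-- Local periods

m<n∸o⇒m+o<n : ∀ m n o → m < n ∸ o → m + o < n
m<n∸o⇒m+o<n m n zero lt = subst (_< n) (sym (+-identityʳ m)) lt
m<n∸o⇒m+o<n m (suc n) (suc o) lt = subst (_< suc n) (sym (+-suc m o)) (s<s (m<n∸o⇒m+o<n m n o lt))

record Periodic {A : Set} (w : ℕ → A) (s n p : ℕ) : Set where
  constructor periodic
  field
    agrees : ∀ j → j + p < n → w (s + j) ≡ w (s + (j + p))

open Periodic

module _ {A : Set} {w : ℕ → A} where

  occursAt⇒Periodic : ∀ {x s p} → OccursAt x w s → IsPeriod x p → Periodic w s (length x) p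
  occursAt⇒Periodic {x} occ (_ , _ , period) = periodic λ j j+p< →
    just-injective (trans (sym (occ j (≤-<-trans (m≤m+n j _) j+p<))) (trans (period j j+p<) (occ (j + _) j+p<)))

  Periodic-prefix : ∀ {s m n p} → m ≤ n → Periodic w s n p → Periodic w s m p
  Periodic-prefix m≤n per = periodic λ j j+p<m → agrees per j (<-≤-trans j+p<m m≤n)

  Periodic-suffix : ∀ {s t n p} → Periodic w s (t + n) p → Periodic w (s + t) n p
  Periodic-suffix {s} {t} {n} {p} per = periodic λ j j+p<n → begin
    w (s + t + j)        ≡⟨ cong w (+-assoc s t j) ⟩
    w (s + (t + j))      ≡⟨ agrees per (t + j) (subst (_< t + n) (sym (+-assoc t j p)) (+-monoʳ-< t j+p<n)) ⟩
    w (s + (t + j + p))  ≡⟨ cong w (trans (cong (s +_) (+-assoc t j p)) (sym (+-assoc s t (j + p)))) ⟩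
    w (s + t + (j + p))  ∎
    where open ≡-Reasoning

  periodic-segment : ∀ {s n p} → Periodic w s n p → segment w (s + p) (n ∸ p) ≡ segment w s (n ∸ p)
  periodic-segment {s} {n} {p} per = segment-cong (n ∸ p) shifted
    where
    shifted : ∀ j → j < n ∸ p → w (s + p + j) ≡ w (s + j)
    shifted j j< = sym (trans (agrees per j (m<n∸o⇒m+o<n j n p j<))
                              (cong w (trans (cong (s +_) (+-comm j p)) (sym (+-assoc s p j)))))

  periodic⇒square : ∀ {i q} → Periodic w i (q + q) q → OccursAt (segment w i q ++ segment w i q) w i
  periodic⇒square {i} {q} per = subst (λ y → OccursAt y w i) square (occursAt-segment w i (q + q))
    where
    square : segment w i (q + q) ≡ segment w i q ++ segment w i q
    square = trans (segment-+ w i q q) (cong (segment w i q ++_)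
               (subst (λ l → segment w (i + q) l ≡ segment w i l) (m+n∸n≡m q q) (periodic-segment per)))

  squareFree⇒¬periodic : ∀ {i q} → SquareFree w → 1 ≤ q → ¬ Periodic w i (q + q) q
  squareFree⇒¬periodic {i} {q} sf 1≤q per =
    sf (segment w i q , subst (1 ≤_) (sym (length-segment w i q)) 1≤q , i , periodic⇒square per)

-- The image of u, block by block

!-nothing⇒length≤ : ∀ {A : Set} (xs : List A) j → xs ! j ≡ nothing → length xs ≤ j
!-nothing⇒length≤ [] j eq = z≤n
!-nothing⇒length≤ (x ∷ xs) (suc j) eq = s≤s (!-nothing⇒length≤ xs j eq)

image : List (Fin 3) → List Bool
image = concatMap gLetter

length-gLetter : ∀ a → length (gLetter a) ≡ 84
length-gLetter Fin.zero = refl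
length-gLetter (Fin.suc Fin.zero) = refl
length-gLetter (Fin.suc (Fin.suc Fin.zero)) = refl

gLetter-injective : ∀ {a b} → gLetter a ≡ gLetter b → a ≡ b
gLetter-injective {Fin.zero} {Fin.zero} _ = refl
gLetter-injective {Fin.suc Fin.zero} {Fin.suc Fin.zero} _ = refl
gLetter-injective {Fin.suc (Fin.suc Fin.zero)} {Fin.suc (Fin.suc Fin.zero)} _ = refl
gLetter-injective {Fin.zero} {Fin.suc Fin.zero} ()
gLetter-injective {Fin.zero} {Fin.suc (Fin.suc Fin.zero)} ()
gLetter-injective {Fin.suc Fin.zero} {Fin.zero} ()
gLetter-injective {Fin.suc Fin.zero} {Fin.suc (Fin.suc Fin.zero)} ()
gLetter-injective {Fin.suc (Fin.suc Fin.zero)} {Fin.zero} ()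
gLetter-injective {Fin.suc (Fin.suc Fin.zero)} {Fin.suc Fin.zero} ()

block-/ : ∀ k {j} → j < 84 → (k * 84 + j) / 84 ≡ k
block-/ k {j} j<84 = trans (+-distrib-/-∣ˡ j (n∣m*n k))
  (trans (cong₂ _+_ (m*n/n≡m k 84) (m<n⇒m/n≡0 j<84)) (+-identityʳ k))

block-% : ∀ k {j} → j < 84 → (k * 84 + j) % 84 ≡ j
block-% k {j} j<84 = trans (%-remove-+ˡ j (n∣m*n k)) (m<n⇒m%n≡m j<84)

module _ (u : ℕ → Fin 3) where

  gInf-! : ∀ i → gLetter (u (i / 84)) ! (i % 84) ≡ just (gInf u i)
  gInf-! i with gLetter (u (i / 84)) ! (i % 84) in eq
  ... | just b = refl
  ... | nothing = ⊥-elim (<⇒≱ (subst (i % 84 <_) (sym (length-gLetter (u (i / 84)))) (m%n<n i 84))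
                                 (!-nothing⇒length≤ (gLetter (u (i / 84))) (i % 84) eq))

  block-occursAt : ∀ k → OccursAt (gLetter (u k)) (gInf u) (k * 84)
  block-occursAt k j j< = subst₂ (λ a r → gLetter (u a) ! r ≡ just (gInf u (k * 84 + j)))
                            (block-/ k j<84) (block-% k j<84) (gInf-! (k * 84 + j))
    where
    j<84 : j < 84
    j<84 = subst (j <_) (length-gLetter (u k)) j<

  block-segment : ∀ k → segment (gInf u) (k * 84) 84 ≡ gLetter (u k)
  block-segment k = sym (subst (λ l → gLetter (u k) ≡ segment (gInf u) (k * 84) l) (length-gLetter (u k))
                               (occursAt⇒segment (gLetter (u k)) (block-occursAt k)))

  image-segment : ∀ k m → image (segment u k m) ≡ segment (gInf u) (k * 84) (m * 84)
  image-segment k zero = refl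
  image-segment k (suc m) = begin
      gLetter (u k) ++ image (segment u (suc k) m)
    ≡⟨ cong₂ _++_ (sym (block-segment k)) (image-segment (suc k) m) ⟩
      segment (gInf u) (k * 84) 84 ++ segment (gInf u) (84 + k * 84) (m * 84)
    ≡⟨ cong (λ i → segment (gInf u) (k * 84) 84 ++ segment (gInf u) i (m * 84)) (+-comm 84 (k * 84)) ⟩
      segment (gInf u) (k * 84) 84 ++ segment (gInf u) (k * 84 + 84) (m * 84)
    ≡⟨ sym (segment-+ (gInf u) (k * 84) 84 (m * 84)) ⟩
      segment (gInf u) (k * 84) (84 + m * 84)
    ∎
    where open ≡-Reasoning

  window-image : ∀ s m l → take l (drop (s % 84) (image (segment u (s / 84) m)))
                           ≡ segment (gInf u) s (l ⊓ (m * 84 ∸ s % 84))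
  window-image s m l = begin
      take l (drop (s % 84) (image (segment u (s / 84) m)))
    ≡⟨ cong (take l ∘ drop (s % 84)) (image-segment (s / 84) m) ⟩
      take l (drop (s % 84) (segment (gInf u) (s / 84 * 84) (m * 84)))
    ≡⟨ window-segment (gInf u) (s / 84 * 84) (s % 84) l (m * 84) ⟩
      segment (gInf u) (s / 84 * 84 + s % 84) (l ⊓ (m * 84 ∸ s % 84))
    ≡⟨ cong (λ i → segment (gInf u) i (l ⊓ (m * 84 ∸ s % 84))) (trans (+-comm _ (s % 84)) (sym (m≡m%n+[m/n]*n s 84))) ⟩
      segment (gInf u) s (l ⊓ (m * 84 ∸ s % 84))
    ∎
    where open ≡-Reasoning

  short-window-image : ∀ s {l} → l ≤ 85 → take l (drop (s % 84) (image (segment u (s / 84) 2))) ≡ segment (gInf u) s l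
  short-window-image s l≤85 = trans (window-image s 2 _)
    (cong (segment (gInf u) s) (m≤n⇒m⊓n≡m (≤-trans l≤85 (∸-monoʳ-≤ 168 (≤-pred (m%n<n s 84))))))

  image-periodic⇒periodic : ∀ {k m q} → Periodic (gInf u) (k * 84) (m * 84) (q * 84) → Periodic u k m q
  image-periodic⇒periodic {k} {m} {q} per = periodic agreement
    where
    open ≡-Reasoning
    shifted : ∀ k j q → k * 84 + j * 84 + q * 84 ≡ (k + (j + q)) * 84
    shifted = solve-∀
    spread : ∀ j q → suc (j + q) * 84 ≡ j * 84 + (84 + q * 84)
    spread = solve-∀
    agreement : ∀ j → j + q < m → u (k + j) ≡ u (k + (j + q))
    agreement j j+q<m = gLetter-injective (begin
      gLetter (u (k + j))                             ≡⟨ sym (block-segment (k + j)) ⟩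
      segment (gInf u) ((k + j) * 84) 84              ≡⟨ cong (λ i → segment (gInf u) i 84) (*-distribʳ-+ 84 k j) ⟩
      segment (gInf u) (k * 84 + j * 84) 84           ≡⟨ sym blocksAgree ⟩
      segment (gInf u) (k * 84 + j * 84 + q * 84) 84  ≡⟨ cong (λ i → segment (gInf u) i 84) (shifted k j q) ⟩
      segment (gInf u) ((k + (j + q)) * 84) 84        ≡⟨ block-segment (k + (j + q)) ⟩
      gLetter (u (k + (j + q)))                       ∎)
      where
      inner : Periodic (gInf u) (k * 84 + j * 84) (84 + q * 84) (q * 84)
      inner = Periodic-suffix (Periodic-prefix (subst (_≤ m * 84) (spread j q) (*-monoˡ-≤ 84 j+q<m)) per)
      blocksAgree : segment (gInf u) (k * 84 + j * 84 + q * 84) 84 ≡ segment (gInf u) (k * 84 + j * 84) 84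
      blocksAgree = subst (λ l → segment (gInf u) (k * 84 + j * 84 + q * 84) l ≡ segment (gInf u) (k * 84 + j * 84) l)
                          (m+n∸n≡m 84 (q * 84)) (periodic-segment inner)

%-≡⇒∣ : ∀ n .{{_ : NonZero n}} i p → (i + p) % n ≡ i % n → n ∣ p
%-≡⇒∣ n i p eq = ∣m+n∣m⇒∣n (subst (n ∣_) quotients (n∣m*n ((i + p) / n))) (n∣m*n (i / n))
  where
  open ≡-Reasoning
  quotients : (i + p) / n * n ≡ i / n * n + p
  quotients = +-cancelˡ-≡ (i % n) _ _ (begin
    i % n + (i + p) / n * n        ≡⟨ cong (_+ (i + p) / n * n) (sym eq) ⟩
    (i + p) % n + (i + p) / n * n  ≡⟨ sym (m≡m%n+[m/n]*n (i + p) n) ⟩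
    i + p                          ≡⟨ cong (_+ p) (m≡m%n+[m/n]*n i n) ⟩
    i % n + i / n * n + p          ≡⟨ +-assoc (i % n) _ p ⟩
    i % n + (i / n * n + p)        ∎)

next-block-start : ∀ s → s + (84 ∸ s % 84) ≡ suc (s / 84) * 84
next-block-start s = begin
  s + (84 ∸ s % 84)                      ≡⟨ cong (_+ (84 ∸ s % 84)) (m≡m%n+[m/n]*n s 84) ⟩
  s % 84 + s / 84 * 84 + (84 ∸ s % 84)   ≡⟨ cong (_+ (84 ∸ s % 84)) (+-comm (s % 84) _) ⟩
  s / 84 * 84 + s % 84 + (84 ∸ s % 84)   ≡⟨ +-assoc (s / 84 * 84) _ _ ⟩
  s / 84 * 84 + (s % 84 + (84 ∸ s % 84)) ≡⟨ cong (s / 84 * 84 +_) (m+[n∸m]≡n (<⇒≤ (m%n<n s 84))) ⟩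
  s / 84 * 84 + 84                       ≡⟨ +-comm _ 84 ⟩
  suc (s / 84) * 84                      ∎
  where open ≡-Reasoning

-- The least n with 11 n > 29 p: a word of length n with period p has exponent above 29/11.
critical : ℕ → ℕ
critical p = suc (29 * p / 11)

critical-≤ : ∀ {p n} → 29 * p < 11 * n → critical p ≤ n
critical-≤ {p} {n} p< = m<n*o⇒m/o<n (subst (29 * p <_) (*-comm 11 n) p<)

11a≤29p<11n⇒a<n : ∀ a p n → 11 * a ≤ 29 * p → 29 * p < 11 * n → a < n
11a≤29p<11n⇒a<n a p n a≤ p< = *-cancelˡ-< 11 a n (≤-<-trans a≤ p<)

38≤p⇒62+p≤n : ∀ {p n} → 38 ≤ p → 29 * p < 11 * n → 62 + p ≤ n
38≤p⇒62+p≤n {p} {n} 38≤p = 11a≤29p<11n⇒a<n (61 + p) p n (begin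
  11 * (61 + p)    ≡⟨ expand p ⟩
  11 * p + 671     ≤⟨ +-monoʳ-≤ (11 * p) (≤-trans (≤ᵇ⇒≤ 671 (18 * 38) _) (*-monoʳ-≤ 18 38≤p)) ⟩
  11 * p + 18 * p  ≡⟨ collect p ⟩
  29 * p           ∎)
  where
  open ≤-Reasoning
  expand : ∀ p → 11 * (61 + p) ≡ 11 * p + 671
  expand = solve-∀
  collect : ∀ p → 11 * p + 18 * p ≡ 29 * p
  collect = solve-∀

168≤p⇒84+2p≤n : ∀ {p n} → 168 ≤ p → 29 * p < 11 * n → 84 + (p + p) ≤ n
168≤p⇒84+2p≤n {p} {n} 168≤p = 11a≤29p<11n⇒a<n (83 + (p + p)) p n (begin
  11 * (83 + (p + p))  ≡⟨ expand p ⟩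
  22 * p + 913         ≤⟨ +-monoʳ-≤ (22 * p) (≤-trans (≤ᵇ⇒≤ 913 (7 * 168) _) (*-monoʳ-≤ 7 168≤p)) ⟩
  22 * p + 7 * p       ≡⟨ collect p ⟩
  29 * p               ∎)
  where
  open ≤-Reasoning
  expand : ∀ p → 11 * (83 + (p + p)) ≡ 22 * p + 913
  expand = solve-∀
  collect : ∀ p → 22 * p + 7 * p ≡ 29 * p
  collect = solve-∀

module BinaryTrie where

  data Trie (A : Set) : Set where
    leaf : Trie A
    node : Maybe A → Trie A → Trie A → Trie A

  lookup : {A : Set} → List Bool → Trie A → Maybe A
  lookup _ leaf = nothing
  lookup [] (node a _ _) = a
  lookup (false ∷ xs) (node _ f t) = lookup xs f
  lookup (true ∷ xs) (node _ f t) = lookup xs t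

  insert : {A : Set} → List Bool → A → Trie A → Trie A
  insert [] a leaf = node (just a) leaf leaf
  insert [] a (node _ f t) = node (just a) f t
  insert (false ∷ xs) a leaf = node nothing (insert xs a leaf) leaf
  insert (true ∷ xs) a leaf = node nothing leaf (insert xs a leaf)
  insert (false ∷ xs) a (node b f t) = node b (insert xs a f) t
  insert (true ∷ xs) a (node b f t) = node b f (insert xs a t)

  -- Nothing is proved about insert: every trie below is only queried by lookup inside a check
  -- that is itself evaluated.
  fromList : {A : Set} → List (List Bool × A) → Trie A
  fromList = foldr (uncurry insert) leaf

open BinaryTrie using (Trie)

_isPrefixOf_ : List Bool → List Bool → Bool
[] isPrefixOf _ = true
(x ∷ xs) isPrefixOf [] = false
(x ∷ xs) isPrefixOf (y ∷ ys) = ⌊ x Bool.≟ y ⌋ ∧ (xs isPrefixOf ys)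

take-isPrefixOf : ∀ n xs → T (take n xs isPrefixOf xs)
take-isPrefixOf zero xs = _
take-isPrefixOf (suc n) [] = _
take-isPrefixOf (suc n) (x ∷ xs) = Equivalence.from Bool.T-∧ (fromWitness refl , take-isPrefixOf n xs)

hasPeriod : ℕ → List Bool → Bool
hasPeriod p w = drop p w isPrefixOf w

periodic⇒hasPeriod : ∀ {w : ℕ → Bool} {s n p} → Periodic w s n p → T (hasPeriod p (segment w s n))
periodic⇒hasPeriod {w} {s} {n} {p} per =
  subst (λ y → T (y isPrefixOf segment w s n)) (sym dropped) (take-isPrefixOf (n ∸ p) (segment w s n))
  where
  dropped : drop p (segment w s n) ≡ take (n ∸ p) (segment w s n)
  dropped = begin
    drop p (segment w s n)            ≡⟨ drop-segment w s p n ⟩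
    segment w (s + p) (n ∸ p)         ≡⟨ periodic-segment per ⟩
    segment w s (n ∸ p)               ≡⟨ cong (segment w s) (sym (m≤n⇒m⊓n≡m (m∸n≤m n p))) ⟩
    segment w s ((n ∸ p) ⊓ n)         ≡⟨ sym (take-segment w s (n ∸ p) n) ⟩
    take (n ∸ p) (segment w s n)      ∎
    where open ≡-Reasoning

T-not⇒¬T : ∀ {b} → T (not b) → ¬ T b
T-not⇒¬T {true} ()

adjacentDistinct : List (Fin 3) → Bool
adjacentDistinct (a ∷ b ∷ v) = not ⌊ a Fin.≟ b ⌋ ∧ adjacentDistinct (b ∷ v)
adjacentDistinct _ = true

words : ℕ → List (List (Fin 3))
words zero = [] ∷ []
words (suc m) = cartesianProductWith _∷_ (allFin 3) (words m)

∈-words : ∀ v → v ∈ words (length v)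
∈-words [] = here refl
∈-words (a ∷ v) = ∈-cartesianProductWith⁺ _∷_ (∈-allFin a) (∈-words v)

admissibleWords : ℕ → List (List (Fin 3))
admissibleWords m = filter (T? ∘ adjacentDistinct) (words m)

-- Consecutive suffixes share their cells, so each image is computed once.
suffixesFrom : ℕ → ℕ → List Bool → List (ℕ × List Bool)
suffixesFrom i zero w = []
suffixesFrom i (suc k) w = (i , w) ∷ suffixesFrom (suc i) k (drop 1 w)

∈-suffixesFrom : ∀ i {r k} w → r < k → (i + r , drop r w) ∈ suffixesFrom i k w
∈-suffixesFrom i {zero} {suc k} w _ = here (cong (_, w) (+-identityʳ i))
∈-suffixesFrom i {suc r} {suc k} w (s<s r<k) = there (subst₂ (λ j y → (j , y) ∈ suffixesFrom (suc i) k (drop 1 w))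
  (sym (+-suc i r)) (drop-drop 1 r w) (∈-suffixesFrom (suc i) (drop 1 w) r<k))

suffixes : ℕ → List (ℕ × List Bool)
suffixes m = concatMap (λ v → suffixesFrom 0 84 (image v)) (admissibleWords m)

everyPosition : ℕ → (ℕ → List Bool → Bool) → Bool
everyPosition m P = all (uncurry P) (suffixes m)

aperiodicPrefix : List Bool → ℕ → Bool
aperiodicPrefix w p = not (hasPeriod p (take (critical p) w))

periodsAbsent : List ℕ → ℕ → List Bool → Bool
periodsAbsent ps _ w = all (aperiodicPrefix w) ps

locatedIn : Trie ℕ → ℕ → List Bool → Bool
locatedIn t r w = ⌊ Maybe.≡-dec _≟_ (BinaryTrie.lookup (take 62 w) t) (just r) ⌋

member : List Bool → Trie ⊤ → Bool
member x t = is-just (BinaryTrie.lookup x t)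

coveredBy : Trie ⊤ → ℕ → List Bool → Bool
coveredBy t _ w = all (λ l → member (take l w) t) (applyUpTo suc 8)

complement₈Outside : Trie ⊤ → ℕ → List Bool → Bool
complement₈Outside t _ w = not (member (compl (take 8 w)) t)

_≟ᴸ_ : (x y : List Bool) → Dec (x ≡ y)
_≟ᴸ_ = List.≡-dec Bool._≟_

open import Data.List.Membership.DecPropositional _≟ᴸ_ using (_∈?_)
open import Data.List.Relation.Unary.Unique.DecPropositional _≟ᴸ_ using (unique?)

listedIfComplementary : List (List Bool) → Trie ⊤ → List Bool → Bool
listedIfComplementary xs t y = not (member (compl y) t) ∨ ⌊ y ∈? xs ⌋

complementaryListed : List (List Bool) → Trie ⊤ → ℕ → List Bool → Bool
complementaryListed xs t _ w = all (λ l → listedIfComplementary xs t (take l w)) (applyUpTo suc 7)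

occursIn : List Bool → List Bool → Bool
occursIn x y = any (λ r → ⌊ take (length x) (drop r y) ≟ᴸ x ⌋) (upTo 84)

occursIn-sound : ∀ {x y} → T (occursIn x y) → ∃ λ r → take (length x) (drop r y) ≡ x
occursIn-sound {x} {y} found =
  let r , match = Any.satisfied (any⁻ (λ r → ⌊ take (length x) (drop r y) ≟ᴸ x ⌋) (upTo 84) found)
  in r , toWitness match

complementaryInEveryImage : List Bool → Bool
complementaryInEveryImage x =
  (1 ≤ᵇ length x) ∧ all (λ a → occursIn x (gLetter a) ∧ occursIn (compl x) (gLetter a)) (allFin 3)

module _ (u : ℕ → Fin 3) where

  occursIn-gLetter⇒factor : ∀ {x} → T (occursIn x (gLetter (u 0))) → IsFactor x (gInf u)
  occursIn-gLetter⇒factor {x} found =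
    let r , match = occursIn-sound {x} {gLetter (u 0)} found
    in r , window≡⇒occursAt {x = x} {gInf u} {0} {r} {84} (trans (cong (take (length x) ∘ drop r) (block-segment u 0)) match)

  listed⇒complementary : ∀ {xs x} → all complementaryInEveryImage xs ≡ true → x ∈ xs → IsComplFactor x (gInf u)
  listed⇒complementary {xs} {x} ok x∈ =
    let nonempty , everywhere = Equivalence.to Bool.T-∧
          (All.lookup (all⁺ complementaryInEveryImage xs (Equivalence.from Bool.T-≡ ok)) x∈)
        found , found′ = Equivalence.to Bool.T-∧ (All.lookup (all⁺ inImage (allFin 3) everywhere) (∈-allFin (u 0)))
    in ≤ᵇ⇒≤ 1 (length x) nonempty , occursIn-gLetter⇒factor {x} found , occursIn-gLetter⇒factor {compl x} found′
    where
    inImage : Fin 3 → Bool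
    inImage a = occursIn x (gLetter a) ∧ occursIn (compl x) (gLetter a)

-- Each check is stated as b ≡ true rather than T b: T b is a unit type once b evaluates, and Agda
-- would re-evaluate b at every use of a proof of T b.

-- Periods below 38 are too short for the synchronisation argument of long-period-impossible,
-- and period 84 (a single block) too short for its square argument.
excludedPeriods : List ℕ
excludedPeriods = 84 ∷ applyUpTo suc 37

noExcludedPeriod : everyPosition 4 (periodsAbsent excludedPeriods) ≡ true
noExcludedPeriod = refl

offsets : Trie ℕ
offsets = BinaryTrie.fromList (map (λ (r , w) → take 62 w , r) (suffixes 2))

located : everyPosition 2 (locatedIn offsets) ≡ true
located = refl

shortFactors : Trie ⊤
shortFactors = BinaryTrie.fromList (concatMap (λ (_ , w) → map (λ l → take l w , tt) (applyUpTo suc 8)) (suffixes 2))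

covered : everyPosition 2 (coveredBy shortFactors) ≡ true
covered = refl

noComplement₈ : everyPosition 2 (complement₈Outside shortFactors) ≡ true
noComplement₈ = refl

complementaryFactors : List (List Bool)
complementaryFactors = map bits
  ( (0 ∷ []) ∷ (1 ∷ [])
  ∷ (0 ∷ 0 ∷ []) ∷ (0 ∷ 1 ∷ []) ∷ (1 ∷ 0 ∷ []) ∷ (1 ∷ 1 ∷ [])
  ∷ (0 ∷ 0 ∷ 1 ∷ []) ∷ (0 ∷ 1 ∷ 0 ∷ []) ∷ (0 ∷ 1 ∷ 1 ∷ []) ∷ (1 ∷ 0 ∷ 0 ∷ []) ∷ (1 ∷ 0 ∷ 1 ∷ []) ∷ (1 ∷ 1 ∷ 0 ∷ [])
  ∷ (0 ∷ 0 ∷ 1 ∷ 1 ∷ []) ∷ (0 ∷ 1 ∷ 0 ∷ 0 ∷ []) ∷ (0 ∷ 1 ∷ 0 ∷ 1 ∷ []) ∷ (0 ∷ 1 ∷ 1 ∷ 0 ∷ [])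
  ∷ (1 ∷ 0 ∷ 0 ∷ 1 ∷ []) ∷ (1 ∷ 0 ∷ 1 ∷ 0 ∷ []) ∷ (1 ∷ 0 ∷ 1 ∷ 1 ∷ []) ∷ (1 ∷ 1 ∷ 0 ∷ 0 ∷ [])
  ∷ (0 ∷ 0 ∷ 1 ∷ 1 ∷ 0 ∷ []) ∷ (0 ∷ 1 ∷ 0 ∷ 0 ∷ 1 ∷ []) ∷ (0 ∷ 1 ∷ 0 ∷ 1 ∷ 1 ∷ []) ∷ (0 ∷ 1 ∷ 1 ∷ 0 ∷ 0 ∷ [])
  ∷ (1 ∷ 0 ∷ 0 ∷ 1 ∷ 1 ∷ []) ∷ (1 ∷ 0 ∷ 1 ∷ 0 ∷ 0 ∷ []) ∷ (1 ∷ 0 ∷ 1 ∷ 1 ∷ 0 ∷ []) ∷ (1 ∷ 1 ∷ 0 ∷ 0 ∷ 1 ∷ [])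
  ∷ (0 ∷ 1 ∷ 0 ∷ 0 ∷ 1 ∷ 1 ∷ []) ∷ (0 ∷ 1 ∷ 0 ∷ 1 ∷ 1 ∷ 0 ∷ []) ∷ (0 ∷ 1 ∷ 1 ∷ 0 ∷ 0 ∷ 1 ∷ [])
  ∷ (1 ∷ 0 ∷ 0 ∷ 1 ∷ 1 ∷ 0 ∷ []) ∷ (1 ∷ 0 ∷ 1 ∷ 0 ∷ 0 ∷ 1 ∷ []) ∷ (1 ∷ 0 ∷ 1 ∷ 1 ∷ 0 ∷ 0 ∷ [])
  ∷ (0 ∷ 1 ∷ 0 ∷ 0 ∷ 1 ∷ 1 ∷ 0 ∷ []) ∷ (1 ∷ 0 ∷ 1 ∷ 1 ∷ 0 ∷ 0 ∷ 1 ∷ [])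
  ∷ [])

complementsListed : everyPosition 2 (complementaryListed complementaryFactors shortFactors) ≡ true
complementsListed = refl

listedComplementary : all complementaryInEveryImage complementaryFactors ≡ true
listedComplementary = refl

excluded-or-long : ∀ p → 1 ≤ p → p ∈ excludedPeriods ⊎ (38 ≤ p × p ≢ 84)
excluded-or-long (suc p) _ with suc p ≟ 84 | p <? 37
... | yes p≡84 | _ = inj₁ (here p≡84)
... | no _ | yes p<37 = inj₁ (there (∈-applyUpTo⁺ suc p<37))
... | no p≢84 | no p≮37 = inj₂ (s≤s (≮⇒≥ p≮37) , p≢84)

module _ {u : ℕ → Fin 3} (sf : SquareFree u) where

  squareFree⇒adjacentDistinct : ∀ k m → T (adjacentDistinct (segment u k m))
  squareFree⇒adjacentDistinct k zero = _
  squareFree⇒adjacentDistinct k (suc zero) = _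
  squareFree⇒adjacentDistinct k (suc (suc m)) =
    Equivalence.from Bool.T-∧ (fromWitnessFalse distinct , squareFree⇒adjacentDistinct (suc k) (suc m))
    where
    distinct : u k ≢ u (suc k)
    distinct eq = squareFree⇒¬periodic sf (s≤s z≤n) square
      where
      square : Periodic u k 2 1
      square = periodic λ where
        zero _ → trans (cong u (+-identityʳ k)) (trans eq (cong u (+-comm 1 k)))
        (suc j) (s<s (s<s j+1≤0)) → ⊥-elim (m+1+n≢0 j (n≤0⇒n≡0 j+1≤0))

  segment∈admissibleWords : ∀ k m → segment u k m ∈ admissibleWords m
  segment∈admissibleWords k m = ∈-filter⁺ (T? ∘ adjacentDistinct)
    (subst (λ n → segment u k m ∈ words n) (length-segment u k m) (∈-words (segment u k m)))
    (squareFree⇒adjacentDistinct k m)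

  everyPosition-sound : ∀ m P → everyPosition m P ≡ true → ∀ s →
                        T (P (s % 84) (drop (s % 84) (image (segment u (s / 84) m))))
  everyPosition-sound m P ok s = All.lookup (all⁺ (uncurry P) (suffixes m) (Equivalence.from Bool.T-≡ ok))
    (∈-concatMap⁺ (λ v → suffixesFrom 0 84 (image v))
      (Any.map (λ { refl → ∈-suffixesFrom 0 _ (m%n<n s 84) }) (segment∈admissibleWords (s / 84) m)))

  periodsAbsent-sound : ∀ {ps s n p} → everyPosition 4 (periodsAbsent ps) ≡ true → p ∈ ps →
                        Periodic (gInf u) s n p → critical p ≤ n → ⊥
  periodsAbsent-sound {ps} {s} {n} {p} ok p∈ per c≤n =
    T-not⇒¬T (subst (λ y → T (not (hasPeriod p y))) (window-image u s 4 (critical p)) absent)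
             (periodic⇒hasPeriod (Periodic-prefix (≤-trans (m⊓n≤m (critical p) (4 * 84 ∸ s % 84)) c≤n) per))
    where
    suffix : List Bool
    suffix = drop (s % 84) (image (segment u (s / 84) 4))
    absent : T (aperiodicPrefix suffix p)
    absent = All.lookup (all⁺ (aperiodicPrefix suffix) ps (everyPosition-sound 4 (periodsAbsent ps) ok s)) p∈

  located-offset : ∀ {t} → everyPosition 2 (locatedIn t) ≡ true → ∀ s →
                   BinaryTrie.lookup (segment (gInf u) s 62) t ≡ just (s % 84)
  located-offset {t} ok s = subst (λ x → BinaryTrie.lookup x t ≡ just (s % 84)) (short-window-image u s (≤ᵇ⇒≤ 62 85 _))
                                  (toWitness (everyPosition-sound 2 (locatedIn t) ok s))

  synchronised : ∀ {t i j} → everyPosition 2 (locatedIn t) ≡ true →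
                 segment (gInf u) i 62 ≡ segment (gInf u) j 62 → i % 84 ≡ j % 84
  synchronised {t} {i} {j} ok eq = just-injective (begin
    just (i % 84)                                ≡⟨ sym (located-offset {t} ok i) ⟩
    BinaryTrie.lookup (segment (gInf u) i 62) t  ≡⟨ cong (λ x → BinaryTrie.lookup x t) eq ⟩
    BinaryTrie.lookup (segment (gInf u) j 62) t  ≡⟨ located-offset {t} ok j ⟩
    just (j % 84)                                ∎)
    where open ≡-Reasoning

  long-period-block-aligned : ∀ {t s n p} → everyPosition 2 (locatedIn t) ≡ true →
                              Periodic (gInf u) s n p → 62 + p ≤ n → 84 ∣ p
  long-period-block-aligned {t} {s} {n} {p} ok per 62+p≤n = %-≡⇒∣ 84 s p (synchronised {t} {s + p} {s} ok (subst
    (λ l → segment (gInf u) (s + p) l ≡ segment (gInf u) s l) (m+n∸n≡m 62 p) (periodic-segment (Periodic-prefix 62+p≤n per))))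

  block-period-impossible : ∀ {s n q} → Periodic (gInf u) s n (q * 84) → 1 ≤ q → 84 + (q * 84 + q * 84) ≤ n → ⊥
  block-period-impossible {s} {n} {q} per 1≤q fits =
    squareFree⇒¬periodic sf 1≤q (image-periodic⇒periodic u {suc (s / 84)} {q + q} {q} aligned)
    where
    aligned : Periodic (gInf u) (suc (s / 84) * 84) ((q + q) * 84) (q * 84)
    aligned = subst (λ i → Periodic (gInf u) i ((q + q) * 84) (q * 84)) (next-block-start s)
      (Periodic-suffix (Periodic-prefix (subst (λ m → 84 ∸ s % 84 + m ≤ n) (sym (*-distribʳ-+ 84 q q))
        (≤-trans (+-monoˡ-≤ _ (m∸n≤m 84 (s % 84))) fits)) per))

  short-factor-member : ∀ {t x s} → everyPosition 2 (coveredBy t) ≡ true → OccursAt x (gInf u) s →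
                   1 ≤ length x → length x ≤ 8 → T (member x t)
  short-factor-member {t} {b ∷ y} {s} ok occ _ (s≤s |y|≤7) = subst (λ z → T (member z t)) window≡x inTrie
    where
    suffix : List Bool
    suffix = drop (s % 84) (image (segment u (s / 84) 2))
    inTrie : T (member (take (suc (length y)) suffix) t)
    inTrie = All.lookup (all⁺ (λ l → member (take l suffix) t) (applyUpTo suc 8) (everyPosition-sound 2 (coveredBy t) ok s))
                        (∈-applyUpTo⁺ suc (s≤s |y|≤7))
    window≡x : take (suc (length y)) suffix ≡ b ∷ y
    window≡x = trans (short-window-image u s (≤-trans (s≤s |y|≤7) (≤ᵇ⇒≤ 8 85 _))) (sym (occursAt⇒segment (b ∷ y) occ))

  no-complementary-pair₈ : ∀ {t} → everyPosition 2 (coveredBy t) ≡ true → everyPosition 2 (complement₈Outside t) ≡ true →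
    ¬ (Σ (List Bool) λ x → (length x ≡ 8) × IsFactor x (gInf u) × IsFactor (compl x) (gInf u))
  no-complementary-pair₈ {t} cover outside (x , |x|≡8 , (s , occ) , (s′ , occ′)) =
    T-not⇒¬T (subst (λ y → T (not (member (compl y) t))) window≡x outsideAt) complementCovered
    where
    |x̄|≡8 : length (compl x) ≡ 8
    |x̄|≡8 = trans (length-map not x) |x|≡8
    outsideAt : T (complement₈Outside t (s % 84) (drop (s % 84) (image (segment u (s / 84) 2))))
    outsideAt = everyPosition-sound 2 (complement₈Outside t) outside s
    window≡x : take 8 (drop (s % 84) (image (segment u (s / 84) 2))) ≡ x
    window≡x = trans (short-window-image u s (≤ᵇ⇒≤ 8 85 _))
                     (trans (cong (segment (gInf u) s) (sym |x|≡8)) (sym (occursAt⇒segment x occ)))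
    complementCovered : T (member (compl x) t)
    complementCovered = short-factor-member {t} {compl x} {s′} cover occ′
                          (subst (1 ≤_) (sym |x̄|≡8) (s≤s z≤n)) (subst (_≤ 8) (sym |x̄|≡8) ≤-refl)

  short-complementary⇒listed : ∀ {t xs x s s′} → everyPosition 2 (coveredBy t) ≡ true →
    everyPosition 2 (complementaryListed xs t) ≡ true → OccursAt x (gInf u) s → OccursAt (compl x) (gInf u) s′ →
    1 ≤ length x → length x ≤ 7 → x ∈ xs
  short-complementary⇒listed {t} {xs} {b ∷ y} {s} {s′} cover listed occ occ′ _ |x|≤7 =
    [ (λ outsideT → ⊥-elim (T-not⇒¬T outsideT complementCovered)) , toWitness ]′
      (Equivalence.to Bool.T-∨ (subst (λ z → T (listedIfComplementary xs t z)) window≡x atS))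
    where
    suffix : List Bool
    suffix = drop (s % 84) (image (segment u (s / 84) 2))
    atS : T (listedIfComplementary xs t (take (suc (length y)) suffix))
    atS = All.lookup (all⁺ (λ l → listedIfComplementary xs t (take l suffix)) (applyUpTo suc 7)
                           (everyPosition-sound 2 (complementaryListed xs t) listed s)) (∈-applyUpTo⁺ suc |x|≤7)
    window≡x : take (suc (length y)) suffix ≡ b ∷ y
    window≡x = trans (short-window-image u s (≤-trans |x|≤7 (≤ᵇ⇒≤ 7 85 _))) (sym (occursAt⇒segment (b ∷ y) occ))
    complementCovered : T (member (compl (b ∷ y)) t)
    complementCovered = short-factor-member {t} {compl (b ∷ y)} {s′} cover occ′ (s≤s z≤n)
                          (subst (_≤ 8) (sym (length-map not (b ∷ y))) (≤-trans |x|≤7 (≤ᵇ⇒≤ 7 8 _)))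

  complementary⇒listed : ∀ {t xs x} → everyPosition 2 (coveredBy t) ≡ true → everyPosition 2 (complement₈Outside t) ≡ true →
    everyPosition 2 (complementaryListed xs t) ≡ true → IsComplFactor x (gInf u) → x ∈ xs
  complementary⇒listed {t} {xs} {x} cover outside listed (1≤|x| , (s , occ) , (s′ , occ′)) =
    [ short-complementary⇒listed {t} {xs} {x} {s} {s′} cover listed occ occ′ 1≤|x| , long-impossible ]′
      (≤-<-connex (length x) 7)
    where
    long-impossible : 7 < length x → x ∈ xs
    long-impossible 7<|x| = ⊥-elim (no-complementary-pair₈ {t} cover outside (take 8 x , length₈ ,
      (s , occursAt-take {x = x} {gInf u} {s} 8 occ) ,
      (s′ , subst (λ z → OccursAt z (gInf u) s′) (take-map {f = not} 8 x)
                  (occursAt-take {x = compl x} {gInf u} {s′} 8 occ′))))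
      where
      length₈ : length (take 8 x) ≡ 8
      length₈ = trans (length-take 8 x) (m≤n⇒m⊓n≡m 7<|x|)

  long-period-impossible : ∀ {s n p} → Periodic (gInf u) s n p → 38 ≤ p → p ≢ 84 → 29 * p < 11 * n → ⊥
  long-period-impossible {s} {n} {p} per 38≤p p≢84 p< =
    multiple-impossible (long-period-block-aligned {offsets} located per (38≤p⇒62+p≤n {p} {n} 38≤p p<))
    where
    multiple-impossible : 84 ∣ p → ⊥
    multiple-impossible (divides zero p≡0) = contradiction (subst (38 ≤_) p≡0 38≤p) λ ()
    multiple-impossible (divides (suc zero) p≡84) = p≢84 p≡84
    multiple-impossible (divides q@(suc (suc q′)) p≡q*84) =
      block-period-impossible {s} {n} {q} (subst (Periodic (gInf u) s n) p≡q*84 per) (s≤s z≤n)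
        (subst (λ m → 84 + (m + m) ≤ n) p≡q*84 (168≤p⇒84+2p≤n {p} {n} 168≤p p<))
      where
      168≤p : 168 ≤ p
      168≤p = subst (168 ≤_) (sym p≡q*84) (+-monoʳ-≤ 84 (m≤m+n 84 (q′ * 84)))

  periodic-factor-bound : ∀ {s n p} → Periodic (gInf u) s n p → 1 ≤ p → 11 * n ≤ 29 * p
  periodic-factor-bound {s} {n} {p} per 1≤p = ≮⇒≥ λ p< →
    [ (λ p∈ → periodsAbsent-sound {excludedPeriods} {s} {n} {p} noExcludedPeriod p∈ per (critical-≤ {p} {n} p<))
    , (λ (38≤p , p≢84) → long-period-impossible per 38≤p p≢84 p<)
    ]′ (excluded-or-long p 1≤p)

theorem19 : (u : ℕ → Fin 3) → SquareFree u →
    RatPlusFree 29 11 (gInf u)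
    × ¬ (Σ (List Bool) λ x → (length x ≡ 8) × IsFactor x (gInf u) × IsFactor (compl x) (gInf u))
    × HasExactlyComplFactors 36 (gInf u)
theorem19 u sf = exponentBound , no-complementary-pair₈ {u} sf {shortFactors} covered noComplement₈ , exactlyComplementary
  where
  exponentBound : RatPlusFree 29 11 (gInf u)
  -- The bound holds for every period of x.
  exponentBound x _ (s , occ) p (period , _) =
    periodic-factor-bound {u} sf (occursAt⇒Periodic {w = gInf u} {x} {s} occ period) (proj₁ period)
  exactlyComplementary : HasExactlyComplFactors 36 (gInf u)
  exactlyComplementary = complementaryFactors , refl , from-yes (unique? complementaryFactors) , λ x →
    mk⇔ (listed⇒complementary u {complementaryFactors} listedComplementary)
        (complementary⇒listed {u} sf {shortFactors} {complementaryFactors} covered noComplement₈ complementsListed)
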